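{- Let $v>r>2$ be integers such that a Steiner system $S(2,r,v)$ exists. If $k=\frac{v(v-1)}{r(r-1)}$ and $n$ is any positive integer divisible by $v$, then $M(k,n)\geq\frac{v}{r}(n-1)$.
   Context: A Steiner system $S(2,r,v)$ is a collection of $r$-element subsets (blocks) of a $v$-element set such that every pair of elements lies in exactly one block. For a finite graph $G$, $\mathrm{Mad}(G)=\max\{2e(H)/|V(H)| : H\subseteq G,\ |V(H)|\geq 1\}$. $M(k,n)$ is the maximum of $\sum_{i=1}^k\mathrm{Mad}(G_i)$ over all partitions of $E(K_n)$ into $k$ spanning subgraphs $G_1,\dots,G_k$. -}

module Defs where

open import Data.Nat as ℕ using (ℕ; zero; suc; _+_; _*_; _∸_; _<_; ≢-nonZero; NonZero)
open import Data.Bool using (Bool; true; false; _∧_; if_then_else_)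
open import Data.Fin using (Fin; zero; suc; toℕ)
open import Data.Fin.Subset using (Subset; _∈_; ∣_∣)
open import Data.Vec using (lookup)
open import Data.List using (List; []; _∷_)
open import Data.Integer using (+_)
open import Data.Rational as ℚ using (ℚ; 0ℚ)
open import Data.Product using (Σ; Σ-syntax; _×_)
open import Relation.Binary.PropositionalEquality using (_≡_; _≢_)
open import Relation.Nullary.Decidable.Core using (does)
open import Data.List.Membership.Propositional as LM using ()
import Data.Fin as F

sumFin : (n : ℕ) → (Fin n → ℕ) → ℕ
sumFin zero    f = 0
sumFin (suc n) f = f zero + sumFin n (λ i → f (suc i))

sumFinℚ : (k : ℕ) → (Fin k → ℚ) → ℚ
sumFinℚ zero    f = 0ℚ
sumFinℚ (suc k) f = f zero ℚ.+ sumFinℚ k (λ i → f (suc i))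

blocksContaining : ∀ {v} → List (Subset v) → Fin v → Fin v → ℕ
blocksContaining []       i j = 0
blocksContaining (B ∷ Bs) i j =
  (if lookup B i ∧ lookup B j then 1 else 0) + blocksContaining Bs i j

IsSteinerSystem : (r v : ℕ) → List (Subset v) → Set
IsSteinerSystem r v blocks =
  (∀ B → B LM.∈ blocks → ∣ B ∣ ≡ r)
  × (∀ (i j : Fin v) → i ≢ j → blocksContaining blocks i j ≡ 1)

SteinerSystemExists : (r v : ℕ) → Set
SteinerSystemExists r v = Σ[ blocks ∈ List (Subset v) ] IsSteinerSystem r v blocks

-- A graph is given by an edge indicator
-- E : Fin n → Fin n → Bool, of which only the entries E i j with
-- toℕ i < toℕ j are meaningful: {i,j} (i<j) is an edge iff E i j ≡ true.

Graph : ℕ → Set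
Graph n = Fin n → Fin n → Bool

IsEdge : ∀ {n} → Graph n → Fin n → Fin n → Set
IsEdge E i j = (toℕ i < toℕ j) × (E i j ≡ true)

edgeCount : ∀ {n} → Graph n → ℕ
edgeCount {n} E =
  sumFin n λ i → sumFin n λ j → if (toℕ i ℕ.<ᵇ toℕ j) ∧ E i j then 1 else 0

record Subgraph {n : ℕ} (G : Graph n) : Set where
  field
    verts    : Subset n
    edges    : Graph n
    nonempty : ∣ verts ∣ ≢ 0
    edges⊆G  : ∀ i j → IsEdge edges i j → IsEdge G i j
    edges⊆S  : ∀ i j → IsEdge edges i j → (i ∈ verts) × (j ∈ verts)

density : ∀ {n} {G : Graph n} → Subgraph G → ℚ
density H = ℚ._/_ (+ (2 * edgeCount (Subgraph.edges H))) ∣ Subgraph.verts H ∣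
              {{≢-nonZero (Subgraph.nonempty H)}}

IsMad : ∀ {n} → Graph n → ℚ → Set
IsMad G q = (Σ[ H ∈ Subgraph G ] density H ≡ q) × (∀ (H : Subgraph G) → density H ℚ.≤ q)

-- Partitions of E(K_n) into k spanning subgraphs G_1..G_k are given by
-- an edge colouring c (only entries c i j with toℕ i < toℕ j matter);
-- G_t has edge {i,j} iff c i j = t.

Colouring : ℕ → ℕ → Set
Colouring k n = Fin n → Fin n → Fin k

colourClass : ∀ {k n} → Colouring k n → Fin k → Graph n
colourClass c t i j = does (c i j F.≟ t)

-- "M(k,n) ≥ x": M(k,n) is the maximum, over the (finitely many, nonempty
-- set of) partitions, of Σ_t Mad(G_t); it is ≥ x iff some partition
-- attains Σ_t Mad(G_t) ≥ x.
MkAtLeast : (k n : ℕ) → ℚ → Set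
MkAtLeast k n x =
  Σ[ c ∈ Colouring k n ] Σ[ mad ∈ (Fin k → ℚ) ]
    (∀ t → IsMad (colourClass c t) (mad t)) × (x ℚ.≤ sumFinℚ k mad)

{-# OPTIONS --safe #-}
module Submission where

-- Blow every point of the Steiner system up into a class of q = n / v vertices and colour the
-- edge between classes x and y (possibly x = y) by a block containing both points.  Colour
-- class t then lives on the q r vertices lying over block t, so Mad(G_t) ≥ 2 e(G_t) / (q r);
-- summing over all colours gives n (n - 1) / (q r) = v (n - 1) / r.  Double counting the pairs
-- covered by the blocks shows that there are exactly k of them.

open import Defs
open import Data.Nat
  using (ℕ; zero; suc; _+_; _*_; _∸_; _≤_; _<_; s≤s; z≤n; NonZero; >-nonZero; ≢-nonZero; ≢-nonZero⁻¹)
open import Data.Nat.Properties using (≤-trans)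
import Data.Nat as ℕ
import Data.Nat.Properties as ℕ
open import Data.Nat.Divisibility using (_∣_; divides)
open import Data.Nat.Tactic.RingSolver using (solve-∀)
open import Algebra.Properties.CommutativeSemigroup ℕ.+-commutativeSemigroup using (interchange)
open import Data.Integer as ℤ using (ℤ; +_)
import Data.Integer.Properties as ℤ
import Data.Integer.Tactic.RingSolver as ℤ-Solver
open import Data.Rational as ℚ using (ℚ; _/_; 0ℚ; 1ℚ; toℚᵘ)
import Data.Rational.Properties as ℚ
open import Data.Rational.Unnormalised as ℚᵘ using (mkℚᵘ; _≃_)
import Data.Rational.Unnormalised.Properties as ℚᵘ
open import Data.Bool using (Bool; true; false; _∧_; if_then_else_)
open import Data.Bool.Properties using (T-≡)
open import Data.Fin as Fin using (Fin; zero; suc; toℕ; remainder; _↑ˡ_; _↑ʳ_)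
import Data.Fin.Properties as Fin
open import Data.Fin.Subset using (Subset; _∈_; ∣_∣; ⊤)
open import Data.Vec using ([]; _∷_; lookup; tabulate)
import Data.Vec.Properties as Vec
open import Data.List using (List; []; _∷_; length)
import Data.List as List
open import Data.List.Membership.Propositional using () renaming (_∈_ to _∈ˡ_)
open import Data.List.Membership.Propositional.Properties using (∈-lookup)
open import Data.List.Relation.Unary.Any as Any using (Any; here; there; index)
open import Data.List.Relation.Unary.Any.Properties using (lookup-index)
open import Data.Product using (Σ; Σ-syntax; _×_; _,_; proj₁; proj₂)
open import Data.Sum using (inj₁; inj₂)
open import Data.Empty using (⊥-elim)
open import Function using (_∘_)
open import Function.Bundles using (Equivalence)
open import Relation.Nullary using (¬_; yes; no; does)
open import Relation.Binary.PropositionalEquality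
  using (_≡_; _≢_; refl; sym; trans; cong; cong₂; subst; subst₂; module ≡-Reasoning)

𝟙 : Bool → ℕ
𝟙 b = if b then 1 else 0

𝟙-∧ : ∀ a b → 𝟙 (a ∧ b) ≡ 𝟙 a * 𝟙 b
𝟙-∧ false b = refl
𝟙-∧ true  b = sym (ℕ.*-identityˡ (𝟙 b))

𝟙-idem : ∀ b → 𝟙 b * 𝟙 b ≡ 𝟙 b
𝟙-idem false = refl
𝟙-idem true  = refl

𝟙-mono : ∀ {a b} → (a ≡ true → b ≡ true) → 𝟙 a ≤ 𝟙 b
𝟙-mono {false} a⇒b = z≤n
𝟙-mono {true}  a⇒b with refl ← a⇒b refl = ℕ.≤-refl

∧-≡-true : ∀ a {b} → a ∧ b ≡ true → a ≡ true × b ≡ true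
∧-≡-true true b≡true = refl , b≡true

∧-true-≡ : ∀ {a b} → a ≡ true → b ≡ true → a ∧ b ≡ true
∧-true-≡ refl refl = refl

∣p∣≡sumFin : ∀ {n} (p : Subset n) → ∣ p ∣ ≡ sumFin n (𝟙 ∘ lookup p)
∣p∣≡sumFin []          = refl
∣p∣≡sumFin (true ∷ p)  = cong suc (∣p∣≡sumFin p)
∣p∣≡sumFin (false ∷ p) = ∣p∣≡sumFin p

sumFin-cong : ∀ n {f g : Fin n → ℕ} → (∀ i → f i ≡ g i) → sumFin n f ≡ sumFin n g
sumFin-cong zero    f≗g = refl
sumFin-cong (suc n) f≗g = cong₂ _+_ (f≗g zero) (sumFin-cong n (f≗g ∘ suc))

sumFin-mono : ∀ n {f g : Fin n → ℕ} → (∀ i → f i ≤ g i) → sumFin n f ≤ sumFin n g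
sumFin-mono zero    f≤g = z≤n
sumFin-mono (suc n) f≤g = ℕ.+-mono-≤ (f≤g zero) (sumFin-mono n (f≤g ∘ suc))

sumFin-0 : ∀ n → sumFin n (λ _ → 0) ≡ 0
sumFin-0 zero    = refl
sumFin-0 (suc n) = sumFin-0 n

sumFin-const : ∀ n c → sumFin n (λ _ → c) ≡ n * c
sumFin-const zero    c = refl
sumFin-const (suc n) c = cong (_+_ c) (sumFin-const n c)

sumFin-+ : ∀ n (f g : Fin n → ℕ) → sumFin n (λ i → f i + g i) ≡ sumFin n f + sumFin n g
sumFin-+ zero    f g = refl
sumFin-+ (suc n) f g =
  trans (cong (_+_ (f zero + g zero)) (sumFin-+ n (f ∘ suc) (g ∘ suc)))
        (interchange (f zero) (g zero) _ _)

sumFin-*ˡ : ∀ n a (f : Fin n → ℕ) → sumFin n (λ i → a * f i) ≡ a * sumFin n f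
sumFin-*ˡ zero    a f = sym (ℕ.*-zeroʳ a)
sumFin-*ˡ (suc n) a f =
  trans (cong (_+_ (a * f zero)) (sumFin-*ˡ n a (f ∘ suc))) (sym (ℕ.*-distribˡ-+ a (f zero) _))

sumFin-swap : ∀ m n (f : Fin m → Fin n → ℕ) →
  sumFin m (λ i → sumFin n (f i)) ≡ sumFin n (λ j → sumFin m (λ i → f i j))
sumFin-swap zero    n f = sym (sumFin-0 n)
sumFin-swap (suc m) n f =
  trans (cong (_+_ (sumFin n (f zero))) (sumFin-swap m n (f ∘ suc))) (sym (sumFin-+ n (f zero) _))

sumFin-↑ : ∀ m n (f : Fin (m + n) → ℕ) →
  sumFin (m + n) f ≡ sumFin m (f ∘ (_↑ˡ n)) + sumFin n (f ∘ (m ↑ʳ_))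
sumFin-↑ zero    n f = refl
sumFin-↑ (suc m) n f =
  trans (cong (_+_ (f zero)) (sumFin-↑ m n (f ∘ suc))) (sym (ℕ.+-assoc (f zero) _ _))

ne : ∀ {n} → Fin n → Fin n → ℕ
ne zero    zero    = 0
ne zero    (suc _) = 1
ne (suc _) zero    = 1
ne (suc x) (suc y) = ne x y

ne-* : ∀ {n} (x y : Fin n) {a b} → (x ≢ y → a ≡ b) → ne x y * a ≡ ne x y * b
ne-* zero    zero    a≡b = refl
ne-* zero    (suc y) a≡b = cong (1 *_) (a≡b λ ())
ne-* (suc x) zero    a≡b = cong (1 *_) (a≡b λ ())
ne-* (suc x) (suc y) a≡b = ne-* x y (λ x≢y → a≡b (x≢y ∘ Fin.suc-injective))

sumFin-ne : ∀ n (x : Fin n) (f : Fin n → ℕ) → sumFin n f ≡ sumFin n (λ y → ne x y * f y) + f x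
sumFin-ne (suc n) zero    f =
  trans (ℕ.+-comm (f zero) _) (cong (_+ f zero) (sumFin-cong n (sym ∘ ℕ.*-identityˡ ∘ f ∘ suc)))
sumFin-ne (suc n) (suc x) f = begin
  f zero + sumFin n (f ∘ suc)      ≡⟨ cong (_+_ (f zero)) (sumFin-ne n x (f ∘ suc)) ⟩
  f zero + (rest + f (suc x))      ≡⟨ ℕ.+-assoc (f zero) rest _ ⟨
  f zero + rest + f (suc x)        ≡⟨ cong (λ a → a + rest + f (suc x)) (ℕ.*-identityˡ (f zero)) ⟨
  1 * f zero + rest + f (suc x)    ∎
  where
  open ≡-Reasoning
  rest = sumFin n (λ y → ne x y * f (suc y))

sumFin-ne-1 : ∀ n (x : Fin n) → sumFin n (ne x) ≡ n ∸ 1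
sumFin-ne-1 n x = begin
  sumFin n (ne x)             ≡⟨ ℕ.m+n∸n≡m _ 1 ⟨
  sumFin n (ne x) + 1 ∸ 1     ≡⟨ cong (_∸ 1) count ⟩
  n ∸ 1                       ∎
  where
  open ≡-Reasoning
  count : sumFin n (ne x) + 1 ≡ n
  count = begin
    sumFin n (ne x) + 1                     ≡⟨ cong (_+ 1) (sumFin-cong n (ℕ.*-identityʳ ∘ ne x)) ⟨
    sumFin n (λ y → ne x y * 1) + 1         ≡⟨ sumFin-ne n x (λ _ → 1) ⟨
    sumFin n (λ _ → 1)                      ≡⟨ sumFin-const n 1 ⟩
    n * 1                                   ≡⟨ ℕ.*-identityʳ n ⟩
    n                                       ∎

sumFin-ne-pairs : ∀ n → sumFin n (λ x → sumFin n (ne x)) ≡ n * (n ∸ 1)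
sumFin-ne-pairs n = trans (sumFin-cong n (sumFin-ne-1 n)) (sumFin-const n (n ∸ 1))

sumFin-ne-square : ∀ n (f : Fin n → ℕ) →
  sumFin n (λ x → sumFin n (λ y → ne x y * (f x * f y))) + sumFin n (λ x → f x * f x)
    ≡ sumFin n f * sumFin n f
sumFin-ne-square n f = begin
  sumFin n (λ x → sumFin n (λ y → ne x y * (f x * f y))) + sumFin n (λ x → f x * f x)
    ≡⟨ sumFin-+ n _ _ ⟨
  sumFin n (λ x → sumFin n (λ y → ne x y * (f x * f y)) + f x * f x)
    ≡⟨ sumFin-cong n (λ x → sumFin-ne n x (λ y → f x * f y)) ⟨
  sumFin n (λ x → sumFin n (λ y → f x * f y))
    ≡⟨ sumFin-cong n (λ x → trans (sumFin-*ˡ n (f x) f) (ℕ.*-comm (f x) _)) ⟩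
  sumFin n (λ x → sumFin n f * f x)
    ≡⟨ sumFin-*ˡ n (sumFin n f) f ⟩
  sumFin n f * sumFin n f
    ∎
  where open ≡-Reasoning

toℚᵘ-/ : ∀ i d → toℚᵘ (i / suc d) ≃ mkℚᵘ i d
toℚᵘ-/ i d = ℚ.toℚᵘ-fromℚᵘ (mkℚᵘ i d)

/-≤-cross : ∀ a b c d .{{_ : NonZero c}} .{{_ : NonZero d}} →
  a * d ≤ b * c → + a / c ℚ.≤ + b / d
/-≤-cross a b (suc c) (suc d) ad≤bc = ℚ.toℚᵘ-cancel-≤
  (ℚᵘ.≤-respʳ-≃ (ℚᵘ.≃-sym (toℚᵘ-/ (+ b) d))
  (ℚᵘ.≤-respˡ-≃ (ℚᵘ.≃-sym (toℚᵘ-/ (+ a) c))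
  (ℚᵘ.*≤* (subst₂ ℤ._≤_ (ℤ.pos-* a (suc d)) (ℤ.pos-* b (suc c)) (ℤ.+≤+ ad≤bc)))))

/-+-/ : ∀ (i j : ℤ) d .{{_ : NonZero d}} → i / d ℚ.+ j / d ≡ (i ℤ.+ j) / d
/-+-/ i j (suc d) = ℚ.toℚᵘ-injective
  (ℚᵘ.≃-trans (ℚ.toℚᵘ-homo-+ (i / suc d) (j / suc d))
  (ℚᵘ.≃-trans (ℚᵘ.+-cong (toℚᵘ-/ i d) (toℚᵘ-/ j d))
  (ℚᵘ.≃-trans (ℚᵘ.*≡* cross) (ℚᵘ.≃-sym (toℚᵘ-/ (i ℤ.+ j) d)))))
  where
  distrib : ∀ i j c → (i ℤ.* c ℤ.+ j ℤ.* c) ℤ.* c ≡ (i ℤ.+ j) ℤ.* (c ℤ.* c)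
  distrib = ℤ-Solver.solve-∀
  cross : (i ℤ.* + suc d ℤ.+ j ℤ.* + suc d) ℤ.* + suc d ≡ (i ℤ.+ j) ℤ.* + (suc d * suc d)
  cross = trans (distrib i j (+ suc d)) (cong ((i ℤ.+ j) ℤ.*_) (sym (ℤ.pos-* (suc d) (suc d))))

sumFinℚ-/ : ∀ k (f : Fin k → ℕ) d .{{_ : NonZero d}} →
  sumFinℚ k (λ t → + f t / d) ≡ + sumFin k f / d
sumFinℚ-/ zero    f d = sym (ℚ.0/n≡0 d)
sumFinℚ-/ (suc k) f d = begin
  + f zero / d ℚ.+ sumFinℚ k (λ t → + f (suc t) / d)
    ≡⟨ cong (+ f zero / d ℚ.+_) (sumFinℚ-/ k (f ∘ suc) d) ⟩
  + f zero / d ℚ.+ + sumFin k (f ∘ suc) / d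
    ≡⟨ /-+-/ (+ f zero) (+ sumFin k (f ∘ suc)) d ⟩
  (+ f zero ℤ.+ + sumFin k (f ∘ suc)) / d
    ≡⟨ cong (λ i → i / d) (ℤ.pos-+ (f zero) _) ⟨
  + sumFin (suc k) f / d
    ∎
  where open ≡-Reasoning

sumFinℚ-mono : ∀ k {f g : Fin k → ℚ} →
  (∀ t → f t ℚ.≤ g t) → sumFinℚ k f ℚ.≤ sumFinℚ k g
sumFinℚ-mono zero    f≤g = ℚ.≤-refl
sumFinℚ-mono (suc k) f≤g = ℚ.+-mono-≤ (f≤g zero) (sumFinℚ-mono k (f≤g ∘ suc))

-- Maximum average degree

argmax : ∀ n (f : Subset n → ℚ) → Σ[ S ∈ Subset n ] (∀ S′ → f S′ ℚ.≤ f S)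
argmax zero    f = [] , λ { [] → ℚ.≤-refl }
argmax (suc n) f with argmax n (f ∘ (false ∷_)) | argmax n (f ∘ (true ∷_))
... | A , A-max | B , B-max with ℚ.≤-total (f (false ∷ A)) (f (true ∷ B))
...   | inj₁ A≤B = true ∷ B , λ { (false ∷ S) → ℚ.≤-trans (A-max S) A≤B
                               ; (true  ∷ S) → B-max S }
...   | inj₂ B≤A = false ∷ A , λ { (false ∷ S) → A-max S
                                ; (true  ∷ S) → ℚ.≤-trans (B-max S) B≤A }

induced : ∀ {n} → Graph n → Subset n → Graph n
induced G S i j = G i j ∧ (lookup S i ∧ lookup S j)

inducedSubgraph : ∀ {n} (G : Graph n) (S : Subset n) → ∣ S ∣ ≢ 0 → Subgraph G
inducedSubgraph G S S≢∅ = record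
  { verts    = S
  ; edges    = induced G S
  ; nonempty = S≢∅
  ; edges⊆G  = λ i j (i<j , e) → i<j , proj₁ (∧-≡-true (G i j) e)
  ; edges⊆S  = λ i j (_ , e) →
      let Si , Sj = ∧-≡-true (lookup S i) (proj₂ (∧-≡-true (G i j) e))
      in Vec.lookup⇒[]= i S Si , Vec.lookup⇒[]= j S Sj
  }

edgeCount-≤-induced : ∀ {n} {G : Graph n} (H : Subgraph G) →
  edgeCount (Subgraph.edges H) ≤ edgeCount (induced G (Subgraph.verts H))
edgeCount-≤-induced {n} {G} H = sumFin-mono n λ i → sumFin-mono n λ j → 𝟙-mono (edge⇒induced i j)
  where
  open Subgraph H
  edge⇒induced : ∀ i j → (toℕ i ℕ.<ᵇ toℕ j) ∧ edges i j ≡ true →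
                 (toℕ i ℕ.<ᵇ toℕ j) ∧ induced G verts i j ≡ true
  edge⇒induced i j e =
    let i<ᵇj , Eij = ∧-≡-true (toℕ i ℕ.<ᵇ toℕ j) e
        isEdge     = ℕ.<ᵇ⇒< (toℕ i) (toℕ j) (Equivalence.from T-≡ i<ᵇj) , Eij
        i∈S , j∈S  = edges⊆S i j isEdge
    in ∧-true-≡ i<ᵇj (∧-true-≡ (proj₂ (edges⊆G i j isEdge))
                               (∧-true-≡ (Vec.[]=⇒lookup i∈S) (Vec.[]=⇒lookup j∈S)))

-- The junk value -1 on the empty vertex set makes every maximiser of edgeDensity nonempty.
edgeDensity : ℕ → ℕ → ℚ
edgeDensity e zero    = ℚ.- 1ℚ
edgeDensity e (suc s) = + (2 * e) / suc s

/≡edgeDensity : ∀ e s .{{_ : NonZero s}} → + (2 * e) / s ≡ edgeDensity e s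
/≡edgeDensity e (suc s) = refl

density≡edgeDensity : ∀ {n} {G : Graph n} (H : Subgraph G) →
  density H ≡ edgeDensity (edgeCount (Subgraph.edges H)) ∣ Subgraph.verts H ∣
density≡edgeDensity H = /≡edgeDensity _ _ {{≢-nonZero (Subgraph.nonempty H)}}

density-≤-induced : ∀ {n} {G : Graph n} (H : Subgraph G) →
  density H ℚ.≤ edgeDensity (edgeCount (induced G (Subgraph.verts H))) ∣ Subgraph.verts H ∣
density-≤-induced {G = G} H = subst (density H ℚ.≤_) (/≡edgeDensity _ _ {{nz}})
  (/-≤-cross (2 * edgeCount (Subgraph.edges H)) (2 * edgeCount (induced G S)) s s {{nz}} {{nz}}
    (ℕ.*-monoˡ-≤ s (ℕ.*-monoʳ-≤ 2 (edgeCount-≤-induced H))))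
  where
  S  = Subgraph.verts H
  s  = ∣ S ∣
  nz = ≢-nonZero (Subgraph.nonempty H)

0≤edgeDensity-suc : ∀ e s → 0ℚ ℚ.≤ edgeDensity e (suc s)
0≤edgeDensity-suc e s = /-≤-cross 0 (2 * e) 1 (suc s) z≤n

0≰-1 : ¬ (0ℚ ℚ.≤ ℚ.- 1ℚ)
0≰-1 (ℚ.*≤* ())

madExists : ∀ {n} .{{_ : NonZero n}} (G : Graph n) → Σ ℚ (IsMad G)
madExists {suc n} G =
  f S₀ , (inducedSubgraph G S₀ S₀≢∅ , density≡edgeDensity (inducedSubgraph G S₀ S₀≢∅))
       , λ H → ℚ.≤-trans (density-≤-induced H) (S₀-max (Subgraph.verts H))
  where
  f : Subset (suc n) → ℚ
  f S = edgeDensity (edgeCount (induced G S)) ∣ S ∣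
  S₀     = proj₁ (argmax (suc n) f)
  S₀-max = proj₂ (argmax (suc n) f)
  S₀≢∅ : ∣ S₀ ∣ ≢ 0
  S₀≢∅ S₀≡∅ = 0≰-1 (ℚ.≤-trans (0≤edgeDensity-suc (edgeCount (induced G ⊤)) ∣ ⊤ {n} ∣)
    (subst (λ s → f ⊤ ℚ.≤ edgeDensity (edgeCount (induced G S₀)) s) S₀≡∅ (S₀-max ⊤)))

-- Colourings of K_n

completeEdgeCount : ℕ → ℕ
completeEdgeCount n = sumFin n λ i → sumFin n λ j → 𝟙 (toℕ i ℕ.<ᵇ toℕ j)

2*completeEdgeCount : ∀ n → 2 * completeEdgeCount n ≡ n * (n ∸ 1)
2*completeEdgeCount zero          = refl
2*completeEdgeCount (suc zero)    = refl
2*completeEdgeCount (suc (suc n)) = begin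
  -- definitionally, the edges at vertex 0 give the first sum and the other vertices form K_(n+1)
  2 * (sumFin (suc n) (λ _ → 1) + completeEdgeCount (suc n))
    ≡⟨ cong (λ a → 2 * (a + completeEdgeCount (suc n))) (sumFin-const (suc n) 1) ⟩
  2 * (suc n * 1 + completeEdgeCount (suc n))
    ≡⟨ ℕ.*-distribˡ-+ 2 (suc n * 1) _ ⟩
  2 * (suc n * 1) + 2 * completeEdgeCount (suc n)
    ≡⟨ cong (_+_ (2 * (suc n * 1))) (2*completeEdgeCount (suc n)) ⟩
  2 * (suc n * 1) + suc n * n
    ≡⟨ triangle n ⟩
  suc (suc n) * suc n
    ∎
  where
  open ≡-Reasoning
  triangle : ∀ n → 2 * (suc n * 1) + suc n * n ≡ suc (suc n) * suc n
  triangle = solve-∀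

sumFin-𝟙≟ : ∀ {k} (a : Fin k) → sumFin k (λ t → 𝟙 (does (a Fin.≟ t))) ≡ 1
sumFin-𝟙≟ {suc k} zero    = cong suc (sumFin-0 k)
sumFin-𝟙≟ {suc k} (suc a) = sumFin-𝟙≟ a

sumFin-edgeCount-colourClass : ∀ {k n} (c : Colouring k n) →
  sumFin k (λ t → edgeCount (colourClass c t)) ≡ completeEdgeCount n
sumFin-edgeCount-colourClass {k} {n} c = begin
  sumFin k (λ t → sumFin n λ i → sumFin n λ j → 𝟙 (i<j i j ∧ does (c i j Fin.≟ t)))
    ≡⟨ sumFin-swap k n _ ⟩
  sumFin n (λ i → sumFin k λ t → sumFin n λ j → 𝟙 (i<j i j ∧ does (c i j Fin.≟ t)))
    ≡⟨ sumFin-cong n (λ i → sumFin-swap k n _) ⟩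
  sumFin n (λ i → sumFin n λ j → sumFin k λ t → 𝟙 (i<j i j ∧ does (c i j Fin.≟ t)))
    ≡⟨ sumFin-cong n (λ i → sumFin-cong n (λ j → oneColour (i<j i j) (c i j))) ⟩
  completeEdgeCount n
    ∎
  where
  open ≡-Reasoning
  i<j : Fin n → Fin n → Bool
  i<j i j = toℕ i ℕ.<ᵇ toℕ j
  oneColour : ∀ b a → sumFin k (λ t → 𝟙 (b ∧ does (a Fin.≟ t))) ≡ 𝟙 b
  oneColour b a = begin
    sumFin k (λ t → 𝟙 (b ∧ does (a Fin.≟ t)))     ≡⟨ sumFin-cong k (𝟙-∧ b ∘ does ∘ (a Fin.≟_)) ⟩
    sumFin k (λ t → 𝟙 b * 𝟙 (does (a Fin.≟ t)))   ≡⟨ sumFin-*ˡ k (𝟙 b) _ ⟩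
    𝟙 b * sumFin k (λ t → 𝟙 (does (a Fin.≟ t)))   ≡⟨ cong (𝟙 b *_) (sumFin-𝟙≟ a) ⟩
    𝟙 b * 1                                        ≡⟨ ℕ.*-identityʳ (𝟙 b) ⟩
    𝟙 b                                            ∎

MkAtLeast-≤ : ∀ {k n x y} → x ℚ.≤ y → MkAtLeast k n y → MkAtLeast k n x
MkAtLeast-≤ x≤y (c , mad , isMad , y≤Σ) = c , mad , isMad , ℚ.≤-trans x≤y y≤Σ

-- Mad(G_t) ≥ 2 e(G_t) / s, and the e(G_t) add up to e(K_n).
MkAtLeast-confined : ∀ {k n s} .{{_ : NonZero n}} .{{_ : NonZero s}}
  (c : Colouring k n) (S : Fin k → Subset n) →
  (∀ t → ∣ S t ∣ ≡ s) →
  (∀ t i j → IsEdge (colourClass c t) i j → i ∈ S t × j ∈ S t) →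
  MkAtLeast k n (+ (n * (n ∸ 1)) / s)
MkAtLeast-confined {k} {n} {s} {{_}} {{s≢0}} c S ∣S∣≡s confined = c , mad , isMad , bound
  where
  mad : Fin k → ℚ
  mad t = proj₁ (madExists (colourClass c t))
  isMad : ∀ t → IsMad (colourClass c t) (mad t)
  isMad t = proj₂ (madExists (colourClass c t))
  H : ∀ t → Subgraph (colourClass c t)
  H t = record
    { verts = S t ; edges = colourClass c t ; nonempty = ≢-nonZero⁻¹ s ∘ trans (sym (∣S∣≡s t))
    ; edges⊆G = λ _ _ e → e ; edges⊆S = confined t }
  e : Fin k → ℕ
  e t = edgeCount (colourClass c t)
  density≤mad : ∀ t → + (2 * e t) / s ℚ.≤ mad t
  density≤mad t = ℚ.≤-trans
    (ℚ.≤-reflexive (ℚ./-cong {+ (2 * e t)} {s} {+ (2 * e t)} {∣ S t ∣}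
                      {{s≢0}} {{≢-nonZero (Subgraph.nonempty (H t))}} refl (sym (∣S∣≡s t))))
    (proj₂ (isMad t) (H t))
  twiceEdges : sumFin k (λ t → 2 * e t) ≡ n * (n ∸ 1)
  twiceEdges = trans (sumFin-*ˡ k 2 e)
    (trans (cong (2 *_) (sumFin-edgeCount-colourClass c)) (2*completeEdgeCount n))
  bound : + (n * (n ∸ 1)) / s ℚ.≤ sumFinℚ k mad
  bound = begin
    + (n * (n ∸ 1)) / s                   ≡⟨ cong (λ a → + a / s) twiceEdges ⟨
    + sumFin k (λ t → 2 * e t) / s        ≡⟨ sumFinℚ-/ k (λ t → 2 * e t) s ⟨
    sumFinℚ k (λ t → + (2 * e t) / s)     ≤⟨ sumFinℚ-mono k density≤mad ⟩
    sumFinℚ k mad                         ∎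
    where open ℚ.≤-Reasoning

-- Steiner systems

pairsIn : ∀ {v} → Subset v → ℕ
pairsIn {v} B = sumFin v λ x → sumFin v λ y → ne x y * 𝟙 (lookup B x ∧ lookup B y)

pairsIn-≡ : ∀ {v} (B : Subset v) → pairsIn B ≡ ∣ B ∣ * (∣ B ∣ ∸ 1)
pairsIn-≡ {v} B = begin
  pairsIn B                ≡⟨ ℕ.m+n∸n≡m (pairsIn B) c ⟨
  pairsIn B + c ∸ c        ≡⟨ cong (_∸ c) pairsIn+c ⟩
  c * c ∸ c                ≡⟨ cong (c * c ∸_) (ℕ.*-identityʳ c) ⟨
  c * c ∸ c * 1            ≡⟨ ℕ.*-distribˡ-∸ c c 1 ⟨
  c * (c ∸ 1)              ∎
  where
  open ≡-Reasoning
  c = ∣ B ∣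
  b : Fin v → ℕ
  b = 𝟙 ∘ lookup B
  pairsIn+c : pairsIn B + c ≡ c * c
  pairsIn+c = begin
    pairsIn B + c
      ≡⟨ cong₂ _+_
           (sumFin-cong v λ x → sumFin-cong v λ y → cong (ne x y *_) (𝟙-∧ (lookup B x) (lookup B y)))
           (trans (∣p∣≡sumFin B) (sumFin-cong v (sym ∘ 𝟙-idem ∘ lookup B))) ⟩
    sumFin v (λ x → sumFin v (λ y → ne x y * (b x * b y))) + sumFin v (λ x → b x * b x)
      ≡⟨ sumFin-ne-square v b ⟩
    sumFin v b * sumFin v b
      ≡⟨ cong₂ _*_ (∣p∣≡sumFin B) (∣p∣≡sumFin B) ⟨
    c * c
      ∎

coveredPairs : ∀ {v} → List (Subset v) → ℕ
coveredPairs {v} Bs = sumFin v λ x → sumFin v λ y → ne x y * blocksContaining Bs x y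

coveredPairs-∷ : ∀ {v} (B : Subset v) Bs → coveredPairs (B ∷ Bs) ≡ pairsIn B + coveredPairs Bs
coveredPairs-∷ {v} B Bs =
  trans (sumFin-cong v λ x →
           trans (sumFin-cong v λ y → ℕ.*-distribˡ-+ (ne x y) _ _) (sumFin-+ v _ _))
        (sumFin-+ v _ _)

coveredPairs-uniform : ∀ {v r} (Bs : List (Subset v)) → (∀ B → B ∈ˡ Bs → ∣ B ∣ ≡ r) →
  coveredPairs Bs ≡ length Bs * (r * (r ∸ 1))
coveredPairs-uniform {v} [] _ =
  trans (sumFin-cong v λ x → trans (sumFin-cong v (ℕ.*-zeroʳ ∘ ne x)) (sumFin-0 v)) (sumFin-0 v)
coveredPairs-uniform {r = r} (B ∷ Bs) ∣Bs∣≡r = begin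
  coveredPairs (B ∷ Bs)
    ≡⟨ coveredPairs-∷ B Bs ⟩
  pairsIn B + coveredPairs Bs
    ≡⟨ cong₂ _+_ (pairsIn-≡ B) (coveredPairs-uniform Bs (λ B′ → ∣Bs∣≡r B′ ∘ there)) ⟩
  ∣ B ∣ * (∣ B ∣ ∸ 1) + length Bs * (r * (r ∸ 1))
    ≡⟨ cong (λ c → c * (c ∸ 1) + _) (∣Bs∣≡r B (here refl)) ⟩
  r * (r ∸ 1) + length Bs * (r * (r ∸ 1))
    ∎
  where open ≡-Reasoning

steiner-blockCount : ∀ {r v} {Bs : List (Subset v)} → IsSteinerSystem r v Bs →
  length Bs * (r * (r ∸ 1)) ≡ v * (v ∸ 1)
steiner-blockCount {v = v} {Bs} (∣Bs∣≡r , unique) =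
  trans (sym (coveredPairs-uniform Bs ∣Bs∣≡r))
        (trans (sumFin-cong v λ x → sumFin-cong v λ y →
                  trans (ne-* x y (unique x y)) (ℕ.*-identityʳ (ne x y)))
               (sumFin-ne-pairs v))

BothIn : ∀ {v} → Fin v → Fin v → Subset v → Set
BothIn x y B = x ∈ B × y ∈ B

blocksContaining≢0 : ∀ {v} (Bs : List (Subset v)) {x y} →
  blocksContaining Bs x y ≢ 0 → Any (BothIn x y) Bs
blocksContaining≢0 []       bc≢0 = ⊥-elim (bc≢0 refl)
blocksContaining≢0 (B ∷ Bs) {x} {y} bc≢0 with lookup B x in Bx | lookup B y in By
... | true  | true  = here (Vec.lookup⇒[]= x B Bx , Vec.lookup⇒[]= y B By)
... | true  | false = there (blocksContaining≢0 Bs bc≢0)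
... | false | _     = there (blocksContaining≢0 Bs bc≢0)

steiner-coversDistinct : ∀ {r v} {Bs : List (Subset v)} → IsSteinerSystem r v Bs →
  ∀ {x y} → x ≢ y → Any (BothIn x y) Bs
steiner-coversDistinct {Bs = Bs} (_ , unique) x≢y =
  blocksContaining≢0 Bs (ℕ.1+n≢0 ∘ trans (sym (unique _ _ x≢y)))

-- With at least two points, every point shares a block with some other point.
steiner-covers : ∀ {r v} {Bs : List (Subset (2 + v))} → IsSteinerSystem r (2 + v) Bs →
  ∀ x y → Any (BothIn x y) Bs
steiner-covers steiner x y with x Fin.≟ y
... | no x≢y   = steiner-coversDistinct steiner x≢y
... | yes refl = Any.map (λ (x∈B , _) → x∈B , x∈B)
                         (steiner-coversDistinct steiner (Fin.punchInᵢ≢i x zero ∘ sym))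

-- Blowing up the points

preimage : ∀ {m n} → (Fin m → Fin n) → Subset n → Subset m
preimage f B = tabulate (lookup B ∘ f)

∈-preimage : ∀ {m n} {f : Fin m → Fin n} {B : Subset n} {i} → f i ∈ B → i ∈ preimage f B
∈-preimage {f = f} {B} {i} fi∈B =
  Vec.lookup⇒[]= i _ (trans (Vec.lookup∘tabulate (lookup B ∘ f) i) (Vec.[]=⇒lookup fi∈B))

remainder-↑ˡ : ∀ {q} v (i : Fin v) → remainder {suc q} v (i ↑ˡ q * v) ≡ i
remainder-↑ˡ {q} v i rewrite Fin.splitAt-↑ˡ v i (q * v) = refl

remainder-↑ʳ : ∀ {q} v (i : Fin (q * v)) → remainder {suc q} v (v ↑ʳ i) ≡ remainder {q} v i
remainder-↑ʳ {q} v i rewrite Fin.splitAt-↑ʳ v (q * v) i = refl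

sumFin-remainder : ∀ q v (h : Fin v → ℕ) → sumFin (q * v) (h ∘ remainder {q} v) ≡ q * sumFin v h
sumFin-remainder zero    v h = refl
sumFin-remainder (suc q) v h = begin
  sumFin (v + q * v) (h ∘ point)
    ≡⟨ sumFin-↑ v (q * v) _ ⟩
  sumFin v (h ∘ point ∘ (_↑ˡ q * v)) + sumFin (q * v) (h ∘ point ∘ (v ↑ʳ_))
    ≡⟨ cong₂ _+_ (sumFin-cong v (cong h ∘ remainder-↑ˡ v))
                 (sumFin-cong (q * v) (cong h ∘ remainder-↑ʳ v)) ⟩
  sumFin v h + sumFin (q * v) (h ∘ remainder {q} v)
    ≡⟨ cong (_+_ (sumFin v h)) (sumFin-remainder q v h) ⟩
  sumFin v h + q * sumFin v h
    ∎
  where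
  open ≡-Reasoning
  point = remainder {suc q} v

∣preimage-remainder∣ : ∀ q {v} (B : Subset v) → ∣ preimage (remainder {q} v) B ∣ ≡ q * ∣ B ∣
∣preimage-remainder∣ q {v} B = begin
  ∣ preimage point B ∣                     ≡⟨ ∣p∣≡sumFin (preimage point B) ⟩
  sumFin (q * v) (𝟙 ∘ lookup (preimage point B))
    ≡⟨ sumFin-cong (q * v) (cong 𝟙 ∘ Vec.lookup∘tabulate (lookup B ∘ point)) ⟩
  sumFin (q * v) (𝟙 ∘ lookup B ∘ point)    ≡⟨ sumFin-remainder q v _ ⟩
  q * sumFin v (𝟙 ∘ lookup B)              ≡⟨ cong (q *_) (∣p∣≡sumFin B) ⟨
  q * ∣ B ∣                                ∎
  where
  open ≡-Reasoning
  point = remainder {q} v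

blowUp-MkAtLeast : ∀ {v r} {Bs : List (Subset (2 + v))} → IsSteinerSystem r (2 + v) Bs →
  ∀ q .{{_ : NonZero q}} .{{_ : NonZero r}} →
  MkAtLeast (length Bs) (q * (2 + v))
    (_/_ (+ (q * (2 + v) * (q * (2 + v) ∸ 1))) (q * r) {{ℕ.m*n≢0 q r}})
blowUp-MkAtLeast {v} {r} {Bs} steiner q =
  MkAtLeast-confined {{ℕ.m*n≢0 q (2 + v)}} {{ℕ.m*n≢0 q r}} colour class class-size confined
  where
  point : Fin (q * (2 + v)) → Fin (2 + v)
  point = remainder {q} (2 + v)
  cover : ∀ x y → Any (BothIn x y) Bs
  cover = steiner-covers steiner
  colour : Colouring (length Bs) (q * (2 + v))
  colour i j = index (cover (point i) (point j))
  class : Fin (length Bs) → Subset (q * (2 + v))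
  class t = preimage point (List.lookup Bs t)
  class-size : ∀ t → ∣ class t ∣ ≡ q * r
  class-size t = trans (∣preimage-remainder∣ q (List.lookup Bs t))
                       (cong (q *_) (proj₁ steiner _ (∈-lookup {xs = Bs} t)))
  confined : ∀ t i j → IsEdge (colourClass colour t) i j → i ∈ class t × j ∈ class t
  confined t i j (_ , coloured-t) with colour i j Fin.≟ t | coloured-t
  ... | yes refl | _ =
    let i∈B , j∈B = lookup-index (cover (point i) (point j)) in ∈-preimage i∈B , ∈-preimage j∈B
  ... | no _     | ()

theorem6p8 : (v r k n : ℕ) → (r>2 : 2 < r) → r < v → SteinerSystemExists r v
    → k * (r * (r ∸ 1)) ≡ v * (v ∸ 1)
    → 0 < n → v ∣ n
    → MkAtLeast k n (_/_ (+ (v * (n ∸ 1))) r {{>-nonZero (≤-trans (s≤s z≤n) r>2)}})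
-- Matching on 2 < r and r < v exposes r and v as 3 + _ and 2 + _.
theorem6p8 v r k n (s≤s (s≤s (s≤s z≤n))) (s≤s (s≤s _)) _ _ () (divides zero refl)
theorem6p8 v r k n (s≤s (s≤s (s≤s z≤n))) (s≤s (s≤s _)) (Bs , steiner) k-blocks _ (divides q@(suc _) refl)
  with refl ← ℕ.*-cancelʳ-≡ (length Bs) k (r * (r ∸ 1)) (trans (steiner-blockCount steiner) (sym k-blocks))
  = MkAtLeast-≤ (/-≤-cross (v * (n ∸ 1)) (n * (n ∸ 1)) r (q * r) (ℕ.≤-reflexive (rescale v q (n ∸ 1) r)))
                (blowUp-MkAtLeast steiner q)
  where
  rescale : ∀ v q m r → v * m * (q * r) ≡ q * v * m * r
  rescale = solve-∀
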